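{- Let $V$ be a finite non-empty set and $T:\mathscr{P}(V)\to\mathscr{P}(V)$ a map. Suppose $(E_1,E_2)$ is a pair of equivalence relations on $V$ with $T(X)=\mathbf{u}_{E_2}(\mathbf{l}_{E_1}(X))$ for all $X\subseteq V$. Then $(E_1,E_2)$ is the unique such pair if and only if: (i) for all $E_2$-classes $[x]_{E_2}\neq[y]_{E_2}$: $\mathbf{u}_{E_1}([x]_{E_2})\neq\mathbf{u}_{E_1}([y]_{E_2})$; and (ii) for every $E_2$-class $[x]_{E_2}$ there is an $E_1$-class $[z]_{E_1}$ with $|[x]_{E_2}\cap[z]_{E_1}|=1$.
   Context: For an equivalence relation $E$ on $V$: $\mathbf{l}_E(X)=\{x:[x]_E\subseteq X\}$, $\mathbf{u}_E(X)=\{x:[x]_E\cap X\neq\emptyset\}$. -}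

module Defs where

open import Data.Nat using (ℕ)
open import Data.Bool using (Bool; true)
open import Data.Fin using (Fin)
open import Data.Fin.Subset using (Subset; _∩_; _⊆_; Nonempty)
open import Data.Fin.Subset.Properties using (_⊆?_; nonempty?)
open import Data.Vec using (tabulate)
open import Data.Product using (_×_)
open import Relation.Nullary.Decidable using (⌊_⌋)
open import Relation.Binary.PropositionalEquality using (_≡_)

-- A (decidable, as every relation on a finite set is classically) binary relation on Fin n.
BRel : ℕ → Set
BRel n = Fin n → Fin n → Bool

_∼[_]_ : ∀ {n} → Fin n → BRel n → Fin n → Set
x ∼[ E ] y = E x y ≡ true

record IsEquivRel {n : ℕ} (E : BRel n) : Set where
  field
    refl′  : ∀ x → x ∼[ E ] x
    sym′   : ∀ {x y} → x ∼[ E ] y → y ∼[ E ] x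
    trans′ : ∀ {x y z} → x ∼[ E ] y → y ∼[ E ] z → x ∼[ E ] z

cls : ∀ {n} → BRel n → Fin n → Subset n
cls E x = tabulate (λ y → E x y)

lower : ∀ {n} → BRel n → Subset n → Subset n
lower E X = tabulate (λ x → ⌊ cls E x ⊆? X ⌋)

upper : ∀ {n} → BRel n → Subset n → Subset n
upper E X = tabulate (λ x → ⌊ nonempty? (cls E x ∩ X) ⌋)

Represents : ∀ {n} → (Subset n → Subset n) → BRel n → BRel n → Set
Represents T E₁ E₂ = IsEquivRel E₁ × IsEquivRel E₂ × (∀ X → T X ≡ upper E₂ (lower E₁ X))

-- Write Meets E₂ E₁ v z when the E₂-class of v meets the E₁-class of z.  T = u_E₂ ∘ l_E₁
-- determines E₁: for a second representing pair (F₁, F₂), every F₁-class contains an E₁-class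
-- and vice versa, which squeezes the classes together.  For fixed E₁, T depends on E₂ only
-- through Meets, as v ∈ T([z]_E₁) exactly when Meets E₂ E₁ v z.  So the pair is unique iff
-- E₂ is the only equivalence relation with its Meets.  If (i) fails, merging two E₂-classes
-- with equal u_E₁-images keeps Meets.  If (ii) fails, every E₁-class meets [x]_E₂ in at least
-- two points, and cutting [x]_E₂ into the least point of each such intersection and the rest
-- keeps Meets.  Conversely, (i) prevents a competitor from joining distinct E₂-classes and
-- (ii) prevents it from cutting one.

module Submission where

open import Defs
open import Data.Bool using (Bool; true; false)
open import Data.Bool.Properties using (⇔→≡) renaming (_≟_ to _≟ᵇ_)
open import Data.Fin using (Fin) renaming (_<_ to _<ᶠ_)
open import Data.Fin.Induction using (<-wellFounded)
open import Data.Fin.Properties using (_≟_; any?; _<?_; <-cmp)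
open import Data.Fin.Subset using (Subset; _∩_; _∈_; _⊆_; Nonempty; ∣_∣; ⁅_⁆; _-_)
open import Data.Fin.Subset.Properties
  using (_∈?_; _⊆?_; nonempty?; ⊆-refl; ⊆-antisym; Empty-unique; ∣⊥∣≡0; ∣⁅x⁆∣≡1; x∈⁅x⁆; x∈⁅y⁆⇒x≡y;
         p⊆q⇒∣p∣≤∣q∣; x∈p∧x≢y⇒x∈p-y; x∈p⇒∣p-x∣<∣p∣; x∈p∩q⁺; x∈p∩q⁻)
open import Data.Nat using (ℕ; suc; _≤_; _<_) renaming (_≟_ to _≟ℕ_)
open import Data.Nat.Properties using (<⇒≱)
open import Data.Product using (∃; _×_; _,_; proj₁; proj₂)
open import Data.Sum using (_⊎_; inj₁; inj₂)
open import Data.Vec using (tabulate; lookup)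
open import Data.Vec.Properties using (lookup∘tabulate; tabulate-cong; ≡-dec; lookup⇒[]=; []=⇒lookup)
open import Function using (_∘_)
open import Function.Bundles using (_⇔_; mk⇔; Equivalence)
open import Induction.WellFounded using (Acc; acc)
open import Level using (0ℓ)
open import Relation.Binary.Core using (Rel)
open import Relation.Binary.Definitions using (Decidable; tri<; tri≈; tri>)
open import Relation.Binary.PropositionalEquality using (_≡_; _≢_; refl; sym; trans; cong; subst; module ≡-Reasoning)
open import Relation.Binary.Structures using (IsEquivalence)
open import Relation.Nullary using (¬_; Dec; yes; no; contradiction; ¬?)
open import Relation.Nullary.Decidable using (⌊_⌋; decidable-stable; _×-dec_; _⊎-dec_; _→-dec_)

open Equivalence using (to; from)

private variable
  n : ℕ
  p : Subset n
  v v′ w x y z : Fin n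
  X : Subset n

isYes⁺ : ∀ {a} {A : Set a} (a? : Dec A) → A → ⌊ a? ⌋ ≡ true
isYes⁺ (yes _) _ = refl
isYes⁺ (no ¬a) a = contradiction a ¬a

isYes⁻ : ∀ {a} {A : Set a} (a? : Dec A) → ⌊ a? ⌋ ≡ true → A
isYes⁻ (yes a) _ = a

isYes-false : ∀ {a} {A : Set a} (a? : Dec A) → ¬ A → ⌊ a? ⌋ ≡ false
isYes-false (yes a) ¬a = contradiction a ¬a
isYes-false (no _) _ = refl

x∈p⇒0<∣p∣ : x ∈ p → 0 < ∣ p ∣
x∈p⇒0<∣p∣ {x = x} x∈p = subst (_≤ _) (∣⁅x⁆∣≡1 x)
  (p⊆q⇒∣p∣≤∣q∣ λ y∈⁅x⁆ → subst (_∈ _) (sym (x∈⁅y⁆⇒x≡y x y∈⁅x⁆)) x∈p)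

∣p∣≡1⇒Nonempty : ∀ {n} {p : Subset n} → ∣ p ∣ ≡ 1 → Nonempty p
∣p∣≡1⇒Nonempty {n} {p} ∣p∣≡1 with nonempty? p
... | yes nonempty = nonempty
... | no empty = contradiction (trans (sym ∣p∣≡1) (trans (cong ∣_∣ (Empty-unique empty)) (∣⊥∣≡0 n))) λ ()

∣p∣≡1⇒∈-unique : ∣ p ∣ ≡ 1 → x ∈ p → y ∈ p → x ≡ y
∣p∣≡1⇒∈-unique {p = p} {x = x} {y} ∣p∣≡1 x∈p y∈p = decidable-stable (x ≟ y) λ x≢y →
  <⇒≱ (subst (∣ p - y ∣ <_) ∣p∣≡1 (x∈p⇒∣p-x∣<∣p∣ y∈p)) (x∈p⇒0<∣p∣ (x∈p∧x≢y⇒x∈p-y x∈p x≢y))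

∣p∣≢1⇒∃-other : ∣ p ∣ ≢ 1 → x ∈ p → ∃ λ y → y ∈ p × y ≢ x
∣p∣≢1⇒∃-other {p = p} {x = x} ∣p∣≢1 x∈p with any? (λ y → y ∈? p ×-dec ¬? (y ≟ x))
... | yes other = other
... | no none = contradiction (trans (cong ∣_∣ p≡⁅x⁆) (∣⁅x⁆∣≡1 x)) ∣p∣≢1
  where
  p≡⁅x⁆ : p ≡ ⁅ x ⁆
  p≡⁅x⁆ = ⊆-antisym
    (λ {y} y∈p → subst (_∈ ⁅ x ⁆) (sym (decidable-stable (y ≟ x) λ y≢x → none (y , y∈p , y≢x))) (x∈⁅x⁆ x))
    (λ {y} y∈⁅x⁆ → subst (_∈ p) (sym (x∈⁅y⁆⇒x≡y x y∈⁅x⁆)) x∈p)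

least-witness : {P : Fin n → Set} → (∀ i → Dec (P i)) → P x → ∃ λ m → P m × (∀ {j} → j <ᶠ m → ¬ P j)
least-witness {P = P} P? = go (<-wellFounded _)
  where
  go : Acc _<ᶠ_ x → P x → ∃ λ m → P m × (∀ {j} → j <ᶠ m → ¬ P j)
  go {x} (acc rs) px with any? (λ j → j <? x ×-dec P? j)
  ... | yes (j , j<x , pj) = go (rs j<x) pj
  ... | no none = x , px , λ j<x pj → none (_ , j<x , pj)

∈-tabulate⁺ : {f : Fin n → Bool} → f x ≡ true → x ∈ tabulate f
∈-tabulate⁺ {x = x} {f} fx = lookup⇒[]= x _ (trans (lookup∘tabulate f x) fx)

∈-tabulate⁻ : {f : Fin n → Bool} → x ∈ tabulate f → f x ≡ true
∈-tabulate⁻ {x = x} {f} x∈ = trans (sym (lookup∘tabulate f x)) ([]=⇒lookup x∈)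

module _ (E : BRel n) where

  ∈-cls⁺ : x ∼[ E ] y → y ∈ cls E x
  ∈-cls⁺ = ∈-tabulate⁺

  ∈-cls⁻ : y ∈ cls E x → x ∼[ E ] y
  ∈-cls⁻ = ∈-tabulate⁻

  ∈-lower⁺ : cls E x ⊆ X → x ∈ lower E X
  ∈-lower⁺ {x = x} {X = X} = ∈-tabulate⁺ ∘ isYes⁺ (cls E x ⊆? X)

  ∈-lower⁻ : x ∈ lower E X → cls E x ⊆ X
  ∈-lower⁻ {x = x} {X = X} = isYes⁻ (cls E x ⊆? X) ∘ ∈-tabulate⁻

  ∈-upper⁺ : x ∼[ E ] y → y ∈ X → x ∈ upper E X
  ∈-upper⁺ {x = x} {X = X} x∼y y∈X =
    ∈-tabulate⁺ (isYes⁺ (nonempty? (cls E x ∩ X)) (_ , x∈p∩q⁺ (∈-cls⁺ x∼y , y∈X)))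

  ∈-upper⁻ : x ∈ upper E X → ∃ λ y → x ∼[ E ] y × y ∈ X
  ∈-upper⁻ {x = x} {X = X} x∈ with isYes⁻ (nonempty? (cls E x ∩ X)) (∈-tabulate⁻ x∈)
  ... | y , y∈∩ = let y∈cls , y∈X = x∈p∩q⁻ (cls E x) X y∈∩ in y , ∈-cls⁻ y∈cls , y∈X

module _ {E : BRel n} (e : IsEquivRel E) where
  open IsEquivRel e

  cls-≡⁺ : x ∼[ E ] y → cls E x ≡ cls E y
  cls-≡⁺ x∼y = tabulate-cong λ z → ⇔→≡ (mk⇔ (trans′ (sym′ x∼y)) (trans′ x∼y))

  cls-≡⁻ : cls E x ≡ cls E y → x ∼[ E ] y
  cls-≡⁻ {y = y} cx≡cy = ∈-cls⁻ E (subst (y ∈_) (sym cx≡cy) (∈-cls⁺ E (refl′ y)))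

lookup-cls : (E : BRel n) (x y : Fin n) → lookup (cls E x) y ≡ E x y
lookup-cls E x = lookup∘tabulate (E x)

lower-cong : {E F : BRel n} → (∀ x y → F x y ≡ E x y) → lower F X ≡ lower E X
lower-cong F≗E = tabulate-cong λ x → cong (λ c → ⌊ c ⊆? _ ⌋) (tabulate-cong (F≗E x))

module _ {R : Rel (Fin n) 0ℓ} (R? : Decidable R) where

  toBRel : BRel n
  toBRel x y = ⌊ R? x y ⌋

  toBRel-isEquivRel : IsEquivalence R → IsEquivRel toBRel
  toBRel-isEquivRel isEq = record
    { refl′  = λ x → isYes⁺ (R? x x) R.refl
    ; sym′   = λ {x} {y} x∼y → isYes⁺ (R? y x) (R.sym (isYes⁻ (R? x y) x∼y))
    ; trans′ = λ {x} {y} {z} x∼y y∼z → isYes⁺ (R? x z) (R.trans (isYes⁻ (R? x y) x∼y) (isYes⁻ (R? y z) y∼z))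
    }
    where module R = IsEquivalence isEq

Meets : BRel n → BRel n → Fin n → Fin n → Set
Meets A E v z = ∃ λ w → v ∼[ A ] w × z ∼[ E ] w

SameMeets : BRel n → BRel n → BRel n → Set
SameMeets E A B = ∀ v z → Meets A E v z ⇔ Meets B E v z

Meets-resp : {A : BRel n} (E : BRel n) → IsEquivRel A → v ∼[ A ] v′ → Meets A E v z → Meets A E v′ z
Meets-resp _ a v∼v′ (w , v∼w , z∼w) = w , trans′ (sym′ v∼v′) v∼w , z∼w
  where open IsEquivRel a

∈-upper-cls⇔Meets : (A E : BRel n) → z ∈ upper E (cls A x) ⇔ Meets A E x z
∈-upper-cls⇔Meets A E = mk⇔
  (λ z∈ → let w , z∼w , w∈ = ∈-upper⁻ E z∈ in w , ∈-cls⁻ A w∈ , z∼w)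
  (λ (w , x∼w , z∼w) → ∈-upper⁺ E z∼w (∈-cls⁺ A x∼w))

module _ {E : BRel n} (e : IsEquivRel E) where
  open IsEquivRel e

  ∈-upper∘lower-cls⇔Meets : {A : BRel n} → v ∈ upper A (lower E (cls E z)) ⇔ Meets A E v z
  ∈-upper∘lower-cls⇔Meets {A = A} = mk⇔
    (λ v∈ → let w , v∼w , w∈ = ∈-upper⁻ A v∈ in
       w , v∼w , ∈-cls⁻ E (∈-lower⁻ E w∈ (∈-cls⁺ E (refl′ w))))
    (λ (w , v∼w , z∼w) → ∈-upper⁺ A v∼w
       (∈-lower⁺ E λ u∈ → ∈-cls⁺ E (trans′ z∼w (∈-cls⁻ E u∈))))

  upper∘lower-mono : {A B : BRel n} → (∀ {v z} → Meets A E v z → Meets B E v z)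
    → upper A (lower E X) ⊆ upper B (lower E X)
  upper∘lower-mono {X = X} {A} {B} A⇒B v∈ =
    let w , v∼w , w∈ = ∈-upper⁻ A v∈
        w′ , v∼w′ , w∼w′ = A⇒B (w , v∼w , refl′ w)
    in ∈-upper⁺ B v∼w′ (∈-lower⁺ E (subst (_⊆ X) (cls-≡⁺ e w∼w′) (∈-lower⁻ E w∈)))

Represents⇒cls⊆cls : {T : Subset n → Subset n} {E₁ E₂ F₁ F₂ : BRel n}
  → Represents T E₁ E₂ → Represents T F₁ F₂ → ∀ x → ∃ λ w → cls E₁ w ⊆ cls F₁ x
Represents⇒cls⊆cls {E₁ = E₁} {E₂} {F₁} {F₂} (_ , _ , hE) (_ , f₂ , hF) x =
  let w , _ , w∈ = ∈-upper⁻ E₂ (subst (x ∈_) (trans (sym (hF _)) (hE _)) x∈Fx)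
  in w , ∈-lower⁻ E₁ w∈
  where
  x∈Fx : x ∈ upper F₂ (lower F₁ (cls F₁ x))
  x∈Fx = ∈-upper⁺ F₂ (IsEquivRel.refl′ f₂ x) (∈-lower⁺ F₁ ⊆-refl)

module _ {T : Subset n → Subset n} {E₁ E₂ F₁ F₂ : BRel n} where

  -- [w′]_F₁ ⊆ [w]_E₁ ⊆ [x]_F₁ with w′ ∈ [x]_F₁, so all three classes coincide.
  Represents⇒lower-unique : Represents T E₁ E₂ → Represents T F₁ F₂ → ∀ x y → F₁ x y ≡ E₁ x y
  Represents⇒lower-unique repE@(e₁ , _) repF@(f₁ , _) x y
    with w , Ew⊆Fx ← Represents⇒cls⊆cls repE repF x
    with w′ , Fw′⊆Ew ← Represents⇒cls⊆cls repF repE w = begin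
    F₁ x y              ≡⟨ lookup-cls F₁ x y ⟨
    lookup (cls F₁ x) y ≡⟨ cong (λ c → lookup c y) (trans Fx≡Ew (cls-≡⁺ e₁ w∼x)) ⟩
    lookup (cls E₁ x) y ≡⟨ lookup-cls E₁ x y ⟩
    E₁ x y              ∎
    where
    open ≡-Reasoning
    open IsEquivRel f₁ using (refl′)
    Fx≡Fw′ : cls F₁ x ≡ cls F₁ w′
    Fx≡Fw′ = cls-≡⁺ f₁ (∈-cls⁻ F₁ (Ew⊆Fx (Fw′⊆Ew (∈-cls⁺ F₁ (refl′ w′)))))
    Fx≡Ew : cls F₁ x ≡ cls E₁ w
    Fx≡Ew = ⊆-antisym (λ {u} u∈Fx → Fw′⊆Ew (subst (u ∈_) Fx≡Fw′ u∈Fx)) Ew⊆Fx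
    w∼x : w ∼[ E₁ ] x
    w∼x = ∈-cls⁻ E₁ (subst (x ∈_) Fx≡Ew (∈-cls⁺ F₁ (refl′ x)))

  Represents⇒SameMeets : Represents T E₁ E₂ → Represents T F₁ F₂ → SameMeets E₁ F₂ E₂
  Represents⇒SameMeets repE@(e₁ , _ , hE) repF@(_ , _ , hF) v z = mk⇔
    (to meets⇔ ∘ subst (v ∈_) F≡E ∘ from meets⇔)
    (to meets⇔ ∘ subst (v ∈_) (sym F≡E) ∘ from meets⇔)
    where
    meets⇔ : {A : BRel n} → v ∈ upper A (lower E₁ (cls E₁ z)) ⇔ Meets A E₁ v z
    meets⇔ = ∈-upper∘lower-cls⇔Meets e₁
    F≡E : upper F₂ (lower E₁ (cls E₁ z)) ≡ upper E₂ (lower E₁ (cls E₁ z))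
    F≡E = trans (cong (upper F₂) (sym (lower-cong (Represents⇒lower-unique repE repF))))
                (trans (sym (hF _)) (hE _))

SameMeets⇒Represents : {T : Subset n → Subset n} {E₁ E₂ A : BRel n}
  → Represents T E₁ E₂ → IsEquivRel A → SameMeets E₁ A E₂ → Represents T E₁ A
SameMeets⇒Represents (e₁ , _ , hE) a same = e₁ , a , λ X → trans (hE X)
  (⊆-antisym (upper∘lower-mono e₁ (from (same _ _))) (upper∘lower-mono e₁ (to (same _ _))))

DeterminedByMeets : BRel n → BRel n → Set
DeterminedByMeets E₁ E₂ = ∀ A → IsEquivRel A → SameMeets E₁ A E₂ → ∀ x y → A x y ≡ E₂ x y

UpperSeparates : BRel n → BRel n → Set
UpperSeparates E₁ E₂ = ∀ x y → cls E₂ x ≢ cls E₂ y → upper E₁ (cls E₂ x) ≢ upper E₁ (cls E₂ y)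

HasSingletonTraces : BRel n → BRel n → Set
HasSingletonTraces E₁ E₂ = ∀ x → ∃ λ z → ∣ cls E₂ x ∩ cls E₁ z ∣ ≡ 1

module _ {E₁ E₂ A : BRel n} (e₂ : IsEquivRel E₂) (a : IsEquivRel A) (same : SameMeets E₁ A E₂) where
  open IsEquivRel

  UpperSeparates⇒⊆ : UpperSeparates E₁ E₂ → x ∼[ A ] y → x ∼[ E₂ ] y
  UpperSeparates⇒⊆ {x = x} {y} separates x∼y =
    cls-≡⁻ e₂ (decidable-stable (≡-dec _≟ᵇ_ (cls E₂ x) (cls E₂ y)) λ cx≢cy →
      separates x y cx≢cy (⊆-antisym (upper-cls-mono x∼y) (upper-cls-mono (sym′ a x∼y))))
    where
    upper-cls-mono : ∀ {u u′} → u ∼[ A ] u′ → upper E₁ (cls E₂ u) ⊆ upper E₁ (cls E₂ u′)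
    upper-cls-mono u∼u′ = from (∈-upper-cls⇔Meets E₂ E₁) ∘ to (same _ _) ∘ Meets-resp E₁ a u∼u′
                        ∘ from (same _ _) ∘ to (∈-upper-cls⇔Meets E₂ E₁)

  -- The unique point of a singleton trace [x]_E₂ ∩ [z]_E₁ is A-related to every point of [x]_E₂.
  HasSingletonTraces⇒⊇ : HasSingletonTraces E₁ E₂ → (∀ {x y} → x ∼[ A ] y → x ∼[ E₂ ] y)
    → ∀ {x y} → x ∼[ E₂ ] y → x ∼[ A ] y
  HasSingletonTraces⇒⊇ traces A⊆E₂ {x} x∼y
    with z , ∣S∣≡1 ← traces x
    with w , w∈S ← ∣p∣≡1⇒Nonempty ∣S∣≡1 = trans′ a (to-w (refl′ e₂ x)) (sym′ a (to-w x∼y))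
    where
    x∼w = proj₁ (x∈p∩q⁻ (cls E₂ x) (cls E₁ z) w∈S)
    z∼w = proj₂ (x∈p∩q⁻ (cls E₂ x) (cls E₁ z) w∈S)
    to-w : ∀ {u} → x ∼[ E₂ ] u → u ∼[ A ] w
    to-w {u} x∼u
      with w′ , u∼w′ , z∼w′ ← from (same u z) (w , trans′ e₂ (sym′ e₂ x∼u) (∈-cls⁻ E₂ x∼w) , ∈-cls⁻ E₁ z∼w) =
      subst (u ∼[ A ]_) (∣p∣≡1⇒∈-unique ∣S∣≡1 w′∈S w∈S) u∼w′
      where
      w′∈S = x∈p∩q⁺ (∈-cls⁺ E₂ (trans′ e₂ x∼u (A⊆E₂ u∼w′)) , ∈-cls⁺ E₁ z∼w′)

conditions⇒DeterminedByMeets : {E₁ E₂ : BRel n} → IsEquivRel E₂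
  → UpperSeparates E₁ E₂ → HasSingletonTraces E₁ E₂ → DeterminedByMeets E₁ E₂
conditions⇒DeterminedByMeets {E₂ = E₂} e₂ separates traces A a same x y =
  ⇔→≡ (mk⇔ A⊆E₂ (HasSingletonTraces⇒⊇ e₂ a same traces A⊆E₂))
  where
  A⊆E₂ : ∀ {x y} → x ∼[ A ] y → x ∼[ E₂ ] y
  A⊆E₂ = UpperSeparates⇒⊆ e₂ a same separates

module _ {E : BRel n} (e : IsEquivRel E) where
  open IsEquivRel e

  module _ (a b : Fin n) where

    Merged : Rel (Fin n) 0ℓ
    Merged u v = u ∼[ E ] v ⊎ (a ∼[ E ] u × b ∼[ E ] v) ⊎ (b ∼[ E ] u × a ∼[ E ] v)

    Merged? : Decidable Merged
    Merged? u v = E u v ≟ᵇ true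
      ⊎-dec ((E a u ≟ᵇ true ×-dec E b v ≟ᵇ true) ⊎-dec (E b u ≟ᵇ true ×-dec E a v ≟ᵇ true))

    Merged-isEquivalence : IsEquivalence Merged
    Merged-isEquivalence = record { refl = inj₁ (refl′ _) ; sym = sym-Merged ; trans = trans-Merged }
      where
      sym-Merged : ∀ {u v} → Merged u v → Merged v u
      sym-Merged (inj₁ u∼v)               = inj₁ (sym′ u∼v)
      sym-Merged (inj₂ (inj₁ (a∼u , b∼v))) = inj₂ (inj₂ (b∼v , a∼u))
      sym-Merged (inj₂ (inj₂ (b∼u , a∼v))) = inj₂ (inj₁ (a∼v , b∼u))

      trans-Merged : ∀ {u v w} → Merged u v → Merged v w → Merged u w
      trans-Merged (inj₁ u∼v)               (inj₁ v∼w)               = inj₁ (trans′ u∼v v∼w)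
      trans-Merged (inj₁ u∼v)               (inj₂ (inj₁ (a∼v , b∼w))) = inj₂ (inj₁ (trans′ a∼v (sym′ u∼v) , b∼w))
      trans-Merged (inj₁ u∼v)               (inj₂ (inj₂ (b∼v , a∼w))) = inj₂ (inj₂ (trans′ b∼v (sym′ u∼v) , a∼w))
      trans-Merged (inj₂ (inj₁ (a∼u , b∼v))) (inj₁ v∼w)               = inj₂ (inj₁ (a∼u , trans′ b∼v v∼w))
      trans-Merged (inj₂ (inj₁ (a∼u , _)))   (inj₂ (inj₁ (_ , b∼w)))   = inj₂ (inj₁ (a∼u , b∼w))
      trans-Merged (inj₂ (inj₁ (a∼u , _)))   (inj₂ (inj₂ (_ , a∼w)))   = inj₁ (trans′ (sym′ a∼u) a∼w)
      trans-Merged (inj₂ (inj₂ (b∼u , a∼v))) (inj₁ v∼w)               = inj₂ (inj₂ (b∼u , trans′ a∼v v∼w))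
      trans-Merged (inj₂ (inj₂ (b∼u , _)))   (inj₂ (inj₁ (_ , b∼w)))   = inj₁ (trans′ (sym′ b∼u) b∼w)
      trans-Merged (inj₂ (inj₂ (b∼u , _)))   (inj₂ (inj₂ (_ , a∼w)))   = inj₂ (inj₂ (b∼u , a∼w))

  module _ (x : Fin n) (g : Fin n → Bool) where

    SplitBy : Rel (Fin n) 0ℓ
    SplitBy u v = u ∼[ E ] v × (x ∼[ E ] u → g u ≡ g v)

    SplitBy? : Decidable SplitBy
    SplitBy? u v = E u v ≟ᵇ true ×-dec (E x u ≟ᵇ true →-dec g u ≟ᵇ g v)

    SplitBy-isEquivalence : IsEquivalence SplitBy
    SplitBy-isEquivalence = record
      { refl  = refl′ _ , λ _ → refl
      ; sym   = λ (u∼v , gu≡gv) → sym′ u∼v , λ x∼v → sym (gu≡gv (trans′ x∼v (sym′ u∼v)))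
      ; trans = λ (u∼v , gu≡gv) (v∼w , gv≡gw) →
                  trans′ u∼v v∼w , λ x∼u → trans (gu≡gv x∼u) (gv≡gw (trans′ x∼u u∼v))
      }

module _ {E₁ E₂ : BRel n} (e₁ : IsEquivRel E₁) (e₂ : IsEquivRel E₂) where
  open IsEquivRel

  merge : Fin n → Fin n → BRel n
  merge a b = toBRel (Merged? e₂ a b)

  merge-SameMeets : ∀ {a b} → upper E₁ (cls E₂ a) ≡ upper E₁ (cls E₂ b) → SameMeets E₁ (merge a b) E₂
  merge-SameMeets {a} {b} ua≡ub v z =
    mk⇔ merged⇒ (λ (w , v∼w , z∼w) → w , isYes⁺ (Merged? e₂ a b v w) (inj₁ v∼w) , z∼w)
    where
    transport : ∀ {c d} → upper E₁ (cls E₂ c) ≡ upper E₁ (cls E₂ d) → Meets E₂ E₁ c z → Meets E₂ E₁ d z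
    transport uc≡ud = to (∈-upper-cls⇔Meets E₂ E₁) ∘ subst (z ∈_) uc≡ud ∘ from (∈-upper-cls⇔Meets E₂ E₁)

    merged⇒ : Meets (merge a b) E₁ v z → Meets E₂ E₁ v z
    merged⇒ (w , v≈w , z∼w) with isYes⁻ (Merged? e₂ a b v w) v≈w
    ... | inj₁ v∼w               = w , v∼w , z∼w
    ... | inj₂ (inj₁ (a∼v , b∼w)) = Meets-resp E₁ e₂ a∼v (transport (sym ua≡ub) (w , b∼w , z∼w))
    ... | inj₂ (inj₂ (b∼v , a∼w)) = Meets-resp E₁ e₂ b∼v (transport ua≡ub (w , a∼w , z∼w))

  DeterminedByMeets⇒UpperSeparates : DeterminedByMeets E₁ E₂ → UpperSeparates E₁ E₂
  DeterminedByMeets⇒UpperSeparates determined x y cx≢cy ux≡uy = cx≢cy (cls-≡⁺ e₂ x∼y)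
    where
    x∼y : x ∼[ E₂ ] y
    x∼y = trans
      (sym (determined (merge x y) (toBRel-isEquivRel _ (Merged-isEquivalence e₂ x y)) (merge-SameMeets ux≡uy) x y))
      (isYes⁺ (Merged? e₂ x y x y) (inj₂ (inj₁ (refl′ e₂ x , refl′ e₂ y))))

  module _ (x : Fin n) where

    trace : Fin n → Subset n
    trace z = cls E₂ x ∩ cls E₁ z

    ∈-trace⁺ : x ∼[ E₂ ] w → z ∼[ E₁ ] w → w ∈ trace z
    ∈-trace⁺ x∼w z∼w = x∈p∩q⁺ (∈-cls⁺ E₂ x∼w , ∈-cls⁺ E₁ z∼w)

    ∈-trace⁻ : w ∈ trace z → x ∼[ E₂ ] w × z ∼[ E₁ ] w
    ∈-trace⁻ {z = z} w∈ = let x∼w , z∼w = x∈p∩q⁻ (cls E₂ x) (cls E₁ z) w∈ in ∈-cls⁻ E₂ x∼w , ∈-cls⁻ E₁ z∼w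

    ∈-trace⇒trace-≡ : w ∈ trace z → trace z ≡ trace w
    ∈-trace⇒trace-≡ w∈ = cong (cls E₂ x ∩_) (cls-≡⁺ e₁ (proj₂ (∈-trace⁻ w∈)))

    notLeast : Fin n → Bool
    notLeast w = ⌊ any? (λ w′ → w′ <? w ×-dec w′ ∈? trace w) ⌋

    split : BRel n
    split = toBRel (SplitBy? e₂ x notLeast)

    module _ (noSingleton : ∀ z → ∣ trace z ∣ ≢ 1) where

      -- The least element of a trace is marked false; as the trace is not a singleton, some larger element is marked true.
      trace-has-marks : w ∈ trace z → ∀ b → ∃ λ m → m ∈ trace z × notLeast m ≡ b
      trace-has-marks {z = z} w∈ b with least-witness (_∈? trace z) w∈
      trace-has-marks {z = z} w∈ false | m , m∈ , least =
        m , m∈ , isYes-false _ λ (j , j<m , j∈) → least j<m (subst (j ∈_) (sym (∈-trace⇒trace-≡ m∈)) j∈)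
      trace-has-marks {z = z} w∈ true | m , m∈ , least with ∣p∣≢1⇒∃-other (noSingleton z) m∈
      ... | m′ , m′∈ , m′≢m = m′ , m′∈ , isYes⁺ _ (m , m<m′ , subst (m ∈_) (∈-trace⇒trace-≡ m′∈) m∈)
        where
        m<m′ : m <ᶠ m′
        m<m′ with <-cmp m m′
        ... | tri< m<m′ _ _ = m<m′
        ... | tri≈ _ m≡m′ _ = contradiction (sym m≡m′) m′≢m
        ... | tri> _ _ m′<m = contradiction m′∈ (least m′<m)

      split-SameMeets : SameMeets E₁ split E₂
      split-SameMeets v z = mk⇔
        (λ (w , v≈w , z∼w) → w , proj₁ (isYes⁻ (SplitBy? e₂ x notLeast v w) v≈w) , z∼w)
        split⇐
        where
        split⇐ : Meets E₂ E₁ v z → Meets split E₁ v z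
        split⇐ (w , v∼w , z∼w) = in-class? (E₂ x v ≟ᵇ true)
          where
          in-class? : Dec (x ∼[ E₂ ] v) → Meets split E₁ v z
          in-class? (no x≁v) = w , isYes⁺ (SplitBy? e₂ x notLeast v w) (v∼w , λ x∼v → contradiction x∼v x≁v) , z∼w
          in-class? (yes x∼v)
            with m , m∈ , mark ← trace-has-marks (∈-trace⁺ (trans′ e₂ x∼v v∼w) z∼w) (notLeast v) =
            m , isYes⁺ (SplitBy? e₂ x notLeast v m) (trans′ e₂ (sym′ e₂ x∼v) (proj₁ (∈-trace⁻ m∈)) , λ _ → sym mark)
              , proj₂ (∈-trace⁻ m∈)

      ¬DeterminedByMeets : ¬ DeterminedByMeets E₁ E₂
      ¬DeterminedByMeets determined
        with m₀ , m₀∈ , mark₀ ← trace-has-marks (∈-trace⁺ (refl′ e₂ x) (refl′ e₁ x)) false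
        with m₁ , m₁∈ , mark₁ ← trace-has-marks (∈-trace⁺ (refl′ e₂ x) (refl′ e₁ x)) true = contradiction
          (trans (sym mark₀) (trans (proj₂ (isYes⁻ (SplitBy? e₂ x notLeast m₀ m₁) m₀≈m₁) x∼m₀) mark₁)) λ ()
        where
        x∼m₀ = proj₁ (∈-trace⁻ m₀∈)
        m₀≈m₁ : m₀ ∼[ split ] m₁
        m₀≈m₁ = trans
          (determined split (toBRel-isEquivRel _ (SplitBy-isEquivalence e₂ x notLeast)) split-SameMeets m₀ m₁)
          (trans′ e₂ (sym′ e₂ x∼m₀) (proj₁ (∈-trace⁻ m₁∈)))

  DeterminedByMeets⇒HasSingletonTraces : DeterminedByMeets E₁ E₂ → HasSingletonTraces E₁ E₂
  DeterminedByMeets⇒HasSingletonTraces determined x with any? (λ z → ∣ trace x z ∣ ≟ℕ 1)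
  ... | yes singleton = singleton
  ... | no none = contradiction determined (¬DeterminedByMeets x λ z ∣S∣≡1 → none (z , ∣S∣≡1))

mainTheorem19 : (n : ℕ) (T : Subset (suc n) → Subset (suc n)) (E₁ E₂ : BRel (suc n))
    → Represents T E₁ E₂
    → ((∀ (F₁ F₂ : BRel (suc n)) → Represents T F₁ F₂
          → (∀ x y → F₁ x y ≡ E₁ x y) × (∀ x y → F₂ x y ≡ E₂ x y))
       ⇔ ((∀ x y → cls E₂ x ≢ cls E₂ y → upper E₁ (cls E₂ x) ≢ upper E₁ (cls E₂ y))
          × (∀ x → ∃ λ z → ∣ cls E₂ x ∩ cls E₁ z ∣ ≡ 1)))
mainTheorem19 n T E₁ E₂ repE@(e₁ , e₂ , _) = mk⇔
  (λ unique → let determined = unique⇒DeterminedByMeets unique in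
     DeterminedByMeets⇒UpperSeparates e₁ e₂ determined , DeterminedByMeets⇒HasSingletonTraces e₁ e₂ determined)
  (λ (separates , traces) F₁ F₂ repF@(_ , f₂ , _) →
     Represents⇒lower-unique repE repF ,
     conditions⇒DeterminedByMeets e₂ separates traces F₂ f₂ (Represents⇒SameMeets repE repF))
  where
  unique⇒DeterminedByMeets : (∀ F₁ F₂ → Represents T F₁ F₂
                                → (∀ x y → F₁ x y ≡ E₁ x y) × (∀ x y → F₂ x y ≡ E₂ x y))
                             → DeterminedByMeets E₁ E₂
  unique⇒DeterminedByMeets unique A a same = proj₂ (unique E₁ A (SameMeets⇒Represents repE a same))
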